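{- Let $l_p$ be a part with primary color $p$ and positive integer size $l$, and let $k_q$ be a part with secondary color $q$ and size $k\ge 2$. Then \[ l_p\not\gg k_q \iff (k+1)_q\gg (l-1)_p, \] and \[ l_p\gg \alpha(k_q)\iff \beta((k+1)_q)\not\succ (l-1)_p. \]
   Context: Colors: primary $a,b,c,d$; secondary $ab,ac,ad,bc,bd,cd$; totally ordered by $ab<ac<ad<a<bc<bd<b<cd<c<d$ (in particular $a<b<c<d$). A colored part $k_p$ has integer size $k$ and color $p$; adding an integer $m$ to a part means $k_p+m=(k+m)_p$ (same color). Write $\chi(S)=1$ if $S$ holds and $0$ otherwise. The strict order $\succ$ on colored parts: $k_p\succ l_q \iff k-l\ge\chi(p\le q)$; $\succeq$ means $\succ$ or equal. Define $\Delta(p,q)=1+\chi(p<q)$ if at least one of $p,q$ is primary; $\Delta(p,q)=1+\chi(p\le q)$ if both are secondary and $(p,q)\notin\{(cd,ab),(ad,bc)\}$; $\Delta(cd,ab)=0$, $\Delta(ad,bc)=1$. The relation $\gg$: $k_p\gg l_q\iff k-l\ge\Delta(p,q)$. For a secondary color $pq$ with primary $p<q$, the upper half $\alpha$ and lower half $\beta$ are defined by $\alpha((2k)_{pq})=k_q$, $\beta((2k)_{pq})=k_p$, $\alpha((2k+1)_{pq})=(k+1)_p$, $\beta((2k+1)_{pq})=k_q$. -}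

module Defs where

open import Data.Bool using (Bool; true; false)
open import Data.Nat as ℕ using (ℕ)
open import Data.Integer as ℤ using (ℤ; +_; _+_; _-_; _≥_)
open import Data.Integer.DivMod using (_/_; _%_)
open import Data.Sum using (_⊎_)
open import Relation.Nullary using (yes; no)
open import Relation.Binary.PropositionalEquality using (_≡_)

data Color : Set where
  a b c d ab ac ad bc bd cd : Color

rank : Color → ℕ
rank ab = 0
rank ac = 1
rank ad = 2
rank a  = 3
rank bc = 4
rank bd = 5
rank b  = 6
rank cd = 7
rank c  = 8
rank d  = 9

data Primary : Color → Set where
  pa : Primary a
  pb : Primary b
  pc : Primary c
  pd : Primary d

data Secondary : Color → Set where
  sab : Secondary ab
  sac : Secondary ac
  sad : Secondary ad
  sbc : Secondary bc
  sbd : Secondary bd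
  scd : Secondary cd

isSecondary : Color → Bool
isSecondary a = false
isSecondary b = false
isSecondary c = false
isSecondary d = false
isSecondary _ = true

χ< : Color → Color → ℤ
χ< p q with rank p ℕ.<? rank q
... | yes _ = + 1
... | no _  = + 0

χ≤ : Color → Color → ℤ
χ≤ p q with rank p ℕ.≤? rank q
... | yes _ = + 1
... | no _  = + 0

record Part : Set where
  constructor _⟨_⟩
  field
    size  : ℤ
    color : Color
open Part public

_+ₚ_ : Part → ℤ → Part
(k ⟨ p ⟩) +ₚ m = (k + m) ⟨ p ⟩

_≻_ : Part → Part → Set
(k ⟨ p ⟩) ≻ (l ⟨ q ⟩) = k - l ≥ χ≤ p q

_⪰_ : Part → Part → Set
x ⪰ y = x ≻ y ⊎ x ≡ y

Δ : Color → Color → ℤ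
Δ cd ab = + 0
Δ ad bc = + 1
Δ p q with isSecondary p | isSecondary q
... | true | true = + 1 + χ≤ p q
... | _    | _    = + 1 + χ< p q

_≫_ : Part → Part → Set
(k ⟨ p ⟩) ≫ (l ⟨ q ⟩) = k - l ≥ Δ p q

lowerC : Color → Color
lowerC ab = a
lowerC ac = a
lowerC ad = a
lowerC bc = b
lowerC bd = b
lowerC cd = c
lowerC x  = x

upperC : Color → Color
upperC ab = b
upperC ac = c
upperC ad = d
upperC bc = c
upperC bd = d
upperC cd = d
upperC x  = x

α : Part → Part
α (n ⟨ r ⟩) with n % + 2
... | 0 = (n / + 2) ⟨ upperC r ⟩
... | _ = ((n / + 2) + + 1) ⟨ lowerC r ⟩

β : Part → Part
β (n ⟨ r ⟩) with n % + 2
... | 0 = (n / + 2) ⟨ lowerC r ⟩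
... | _ = (n / + 2) ⟨ upperC r ⟩

module Submission where

-- Every relation involved is a threshold condition "difference of sizes ≥ constant".
-- Both equivalences therefore reduce to one arithmetic fact: if two integers sum to -1,
-- exactly one of them is nonnegative (threshold-complement).  What remains is to see that
-- the constants fit:
--   * for a primary and a secondary colour the two gaps Δ(p,q), Δ(q,p) sum to 3
--     (a finite check on the colour table), which gives the first equivalence for parts
--     of arbitrary sizes (swapped-gap);
--   * for a primary colour p and any colour r, Δ(p,r) + χ(r ≤ p) = 2, which relates ≫
--     from a primary part to ≻ back to it (primary-gap);
--   * the upper half of k_q equals the lower half of (k+1)_q, i.e. α(k_q) = β((k+1)_q)
--     (α≡β-next, by induction on k in steps of two), so the second equivalence is
--     primary-gap applied to the part α(k_q).

open import Defs
open import Data.Integer using (ℤ; +_; -1ℤ; _>_; _≥_)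
open import Data.Product using (_×_)
open import Function.Bundles using (_⇔_)
open import Relation.Nullary using (¬_)

open import Data.Integer using (-[1+_]; 0ℤ; _+_; _-_; _≤_; +≤+; _/_; _%_)
import Data.Integer.Properties as ℤₚ
open import Data.Integer.DivMod using (div-pos-is-/ℕ)
open import Data.Integer.Tactic.RingSolver using (solve-∀)
open import Data.Nat as ℕ using (suc; z≤n)
import Data.Nat.Properties as ℕₚ
import Data.Nat.DivMod as ℕ÷
open import Data.Product using (_,_)
open import Data.Empty using (⊥-elim)
open import Function.Bundles using (mk⇔; Equivalence)
import Function.Properties.Equivalence as ⇔
open import Relation.Nullary using (yes; no)
open import Relation.Binary.PropositionalEquality using (_≡_; refl; cong; subst; module ≡-Reasoning)

nonneg-complement : ∀ i j → i + j ≡ -1ℤ → (0ℤ ≤ i) ⇔ (¬ (0ℤ ≤ j))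
nonneg-complement (+ m)    (+ n)    ()
nonneg-complement (+ m)    -[1+ n ] _ = mk⇔ (λ _ ()) (λ _ → +≤+ z≤n)
nonneg-complement -[1+ m ] (+ n)    _ = mk⇔ (λ ()) (λ j≱0 → ⊥-elim (j≱0 (+≤+ z≤n)))
nonneg-complement -[1+ m ] -[1+ n ] ()

threshold-complement : ∀ {x y u v} → (x - y) + (u - v) ≡ -1ℤ → (x ≥ y) ⇔ (¬ (u ≥ v))
threshold-complement {x} {y} {u} {v} eq = mk⇔
  (λ y≤x v≤u → to (ℤₚ.i≤j⇒0≤j-i y≤x) (ℤₚ.i≤j⇒0≤j-i v≤u))
  (λ u≱v → ℤₚ.0≤i-j⇒j≤i (from (λ 0≤u-v → u≱v (ℤₚ.0≤i-j⇒j≤i 0≤u-v))))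
  where open Equivalence (nonneg-complement (x - y) (u - v) eq)

χ<-χ≤-complement : ∀ p r → χ< p r + χ≤ r p ≡ + 1
χ<-χ≤-complement p r with rank p ℕ.<? rank r | rank r ℕ.≤? rank p
... | yes p<r | yes r≤p = ⊥-elim (ℕₚ.<⇒≱ p<r r≤p)
... | yes _   | no _    = refl
... | no _    | yes _   = refl
... | no p≮r  | no r≰p  = ⊥-elim (r≰p (ℕₚ.≮⇒≥ p≮r))

Δ-primary : ∀ {p} → Primary p → ∀ r → Δ p r ≡ + 1 + χ< p r
Δ-primary pa r = refl
Δ-primary pb r = refl
Δ-primary pc r = refl
Δ-primary pd r = refl

-- Between a primary and a secondary colour the gaps in both directions sum to 3
-- (both are 1 + χ(·<·), and exactly one of the two strict comparisons holds).
Δ-mixed-sum : ∀ {p q} → Primary p → Secondary q → Δ p q + Δ q p ≡ + 3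
Δ-mixed-sum pa sab = refl
Δ-mixed-sum pb sab = refl
Δ-mixed-sum pc sab = refl
Δ-mixed-sum pd sab = refl
Δ-mixed-sum pa sac = refl
Δ-mixed-sum pb sac = refl
Δ-mixed-sum pc sac = refl
Δ-mixed-sum pd sac = refl
Δ-mixed-sum pa sad = refl
Δ-mixed-sum pb sad = refl
Δ-mixed-sum pc sad = refl
Δ-mixed-sum pd sad = refl
Δ-mixed-sum pa sbc = refl
Δ-mixed-sum pb sbc = refl
Δ-mixed-sum pc sbc = refl
Δ-mixed-sum pd sbc = refl
Δ-mixed-sum pa sbd = refl
Δ-mixed-sum pb sbd = refl
Δ-mixed-sum pc sbd = refl
Δ-mixed-sum pd sbd = refl
Δ-mixed-sum pa scd = refl
Δ-mixed-sum pb scd = refl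
Δ-mixed-sum pc scd = refl
Δ-mixed-sum pd scd = refl

swapped-gap : ∀ {p q} → Δ p q + Δ q p ≡ + 3 → ∀ x y →
  (¬ ((x ⟨ p ⟩) ≫ (y ⟨ q ⟩))) ⇔ (((y ⟨ q ⟩) +ₚ (+ 1)) ≫ ((x ⟨ p ⟩) +ₚ -1ℤ))
swapped-gap {p} {q} gaps x y = ⇔.sym (threshold-complement slacks)
  where
  slacks : (((y + + 1) - (x + -1ℤ)) - Δ q p) + ((x - y) - Δ p q) ≡ -1ℤ
  slacks = begin
    (((y + + 1) - (x + -1ℤ)) - Δ q p) + ((x - y) - Δ p q)
      ≡⟨ regroup x y (Δ p q) (Δ q p) ⟩
    + 2 - (Δ p q + Δ q p)
      ≡⟨ cong (_-_ (+ 2)) gaps ⟩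
    -1ℤ ∎
    where
    open ≡-Reasoning
    regroup : ∀ x y d e → (((y + + 1) - (x + -1ℤ)) - e) + ((x - y) - d) ≡ + 2 - (d + e)
    regroup = solve-∀

primary-gap : ∀ {p} → Primary p → ∀ x m r →
  ((x ⟨ p ⟩) ≫ (m ⟨ r ⟩)) ⇔ (¬ ((m ⟨ r ⟩) ≻ ((x ⟨ p ⟩) +ₚ -1ℤ)))
primary-gap {p} pp x m r = threshold-complement slacks
  where
  gaps : Δ p r + χ≤ r p ≡ + 2
  gaps = begin
    Δ p r + χ≤ r p          ≡⟨ cong (_+ χ≤ r p) (Δ-primary pp r) ⟩
    + 1 + χ< p r + χ≤ r p   ≡⟨ ℤₚ.+-assoc (+ 1) (χ< p r) (χ≤ r p) ⟩
    + 1 + (χ< p r + χ≤ r p) ≡⟨ cong (_+_ (+ 1)) (χ<-χ≤-complement p r) ⟩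
    + 2 ∎
    where open ≡-Reasoning
  slacks : ((x - m) - Δ p r) + ((m - (x + -1ℤ)) - χ≤ r p) ≡ -1ℤ
  slacks = begin
    ((x - m) - Δ p r) + ((m - (x + -1ℤ)) - χ≤ r p) ≡⟨ regroup x m (Δ p r) (χ≤ r p) ⟩
    + 1 - (Δ p r + χ≤ r p)                           ≡⟨ cong (_-_ (+ 1)) gaps ⟩
    -1ℤ ∎
    where
    open ≡-Reasoning
    regroup : ∀ x m d e → ((x - m) - d) + ((m - (x + -1ℤ)) - e) ≡ + 1 - (d + e)
    regroup = solve-∀

half-step : ∀ n → + (2 ℕ.+ n) / + 2 ≡ (+ n / + 2) + + 1
half-step n = begin
  + (2 ℕ.+ n) / + 2   ≡⟨ div-pos-is-/ℕ (+ (2 ℕ.+ n)) 2 ⟩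
  + ((2 ℕ.+ n) ℕ./ 2) ≡⟨ cong +_ (ℕ÷.m/n≡1+[m∸n]/n (ℕₚ.m≤m+n 2 n)) ⟩
  + (1 ℕ.+ n ℕ./ 2)   ≡⟨ cong +_ (ℕₚ.+-comm 1 (n ℕ./ 2)) ⟩
  + (n ℕ./ 2) + + 1   ≡⟨ cong (_+ + 1) (div-pos-is-/ℕ (+ n) 2) ⟨
  (+ n / + 2) + + 1   ∎
  where open ≡-Reasoning

-- Adding 2 to a part keeps the parity of its size, so its halves grow by 1 and keep
-- their colours.  (The parity n % 2 of 2 + n reduces to that of n.)
α-shift : ∀ n r → α ((+ (2 ℕ.+ n)) ⟨ r ⟩) ≡ α ((+ n) ⟨ r ⟩) +ₚ (+ 1)
α-shift n r with + n % + 2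
... | 0     = cong (_⟨ upperC r ⟩) (half-step n)
... | suc _ = cong (λ h → (h + + 1) ⟨ lowerC r ⟩) (half-step n)

β-shift : ∀ n r → β ((+ (2 ℕ.+ n)) ⟨ r ⟩) ≡ β ((+ n) ⟨ r ⟩) +ₚ (+ 1)
β-shift n r with + n % + 2
... | 0     = cong (_⟨ lowerC r ⟩) (half-step n)
... | suc _ = cong (_⟨ upperC r ⟩) (half-step n)

α≡β-next : ∀ n r → α ((+ n) ⟨ r ⟩) ≡ β (((+ n) ⟨ r ⟩) +ₚ (+ 1))
α≡β-next 0 r = refl
α≡β-next 1 r = refl
α≡β-next (suc (suc n)) r = begin
  α ((+ (2 ℕ.+ n)) ⟨ r ⟩)            ≡⟨ α-shift n r ⟩
  α ((+ n) ⟨ r ⟩) +ₚ (+ 1)           ≡⟨ cong (_+ₚ (+ 1)) (α≡β-next n r) ⟩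
  β ((+ (n ℕ.+ 1)) ⟨ r ⟩) +ₚ (+ 1)   ≡⟨ β-shift (n ℕ.+ 1) r ⟨
  β ((+ (2 ℕ.+ (n ℕ.+ 1))) ⟨ r ⟩)    ∎
  where open ≡-Reasoning

-- The size k ≥ 2 is nonnegative, so k = + n.
lemma2p1 : (l k : ℤ) (p q : Color) → Primary p → Secondary q → l > + 0 → k ≥ + 2 →
    ((¬ ((l ⟨ p ⟩) ≫ (k ⟨ q ⟩))) ⇔ (((k ⟨ q ⟩) +ₚ (+ 1)) ≫ ((l ⟨ p ⟩) +ₚ -1ℤ)))
    × (((l ⟨ p ⟩) ≫ α (k ⟨ q ⟩)) ⇔ (¬ (β ((k ⟨ q ⟩) +ₚ (+ 1)) ≻ ((l ⟨ p ⟩) +ₚ -1ℤ))))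
lemma2p1 l (+ n) p q pp sq _ _ =
  swapped-gap {p} {q} (Δ-mixed-sum pp sq) l (+ n) ,
  subst (λ y → ((l ⟨ p ⟩) ≫ α kq) ⇔ (¬ (y ≻ ((l ⟨ p ⟩) +ₚ -1ℤ))))
        (α≡β-next n q)
        (primary-gap pp l (size (α kq)) (color (α kq)))
  where
  kq : Part
  kq = (+ n) ⟨ q ⟩
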